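{- Let $C$ be a labeled canonical configuration. No permutation in $G_C$ moves any core token of $C$.
   Context: Tokens occupy distinct cells of $\mathbb{Z}^2$ and are regarded as distinct objects. The bounding box is the smallest axis-parallel rectangle containing all tokens; configurations are identified up to translation. A push in direction "left": translate so that the lower-left corner of the bounding box is $(0,0)$; for columns $i=1,2,\dots$ in increasing order and every row $j$, if $(i,j)$ is full and $(i-1,j)$ is empty, move the token from $(i,j)$ to $(i-1,j)$. Pushes in directions right, up, down are defined symmetrically. A configuration is canonical if applying a push in direction left or a push in direction down leaves the set of occupied cells unchanged (up to translation); it is compact if it can be obtained from a canonical configuration by pushes. For compact $C$, $G_C$ is the group of permutations $\pi$ of the occupied cells of $C$ such that some finite sequence of pushes transforms $C$ into a configuration with the same set of occupied cells in which the token originally at $p$ is at $\pi(p)$ for every occupied $p$. Core: let the bounding box of $C$ have $a$ columns and $b$ rows, let $a'$ be the number of completely full columns and $b'$ the number of completely full rows, and set $a''=a-a'$, $b''=b-b'$. If $a'>a''$ and $b'>b''$, the core of $C$ is the set of cells of the bounding box lying in the central $a'-a''$ columns (i.e. excluding the $a''$ leftmost and $a''$ rightmost columns) and in the central $b'-b''$ rows (excluding the $b''$ topmost and $b''$ bottommost rows); otherwise the core is empty. Core tokens are tokens in core cells. -}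

module Defs where

open import Data.Nat using (ℕ; zero; suc; _+_; _∸_; _⊔_; _⊓_; _≤_; _<_; _≡ᵇ_)
open import Data.Nat.Properties using () renaming (_≟_ to _≟ℕ_)
open import Data.Bool using (Bool; true; false; if_then_else_; _∧_; not)
open import Data.Product using (_×_; _,_; proj₁; proj₂)
open import Data.Product.Properties using (≡-dec)
open import Data.Vec using (Vec; []; _∷_; map; lookup; toList)
open import Data.Vec.Membership.Propositional using (_∈_)
open import Data.List using (List; []; _∷_; foldl; upTo; filter; length)
open import Data.Bool.ListAction using (all; any)
open import Data.Fin using (Fin)
open import Data.Fin.Permutation using (Permutation′; _⟨$⟩ʳ_)
open import Data.Product using (∃)
open import Function.Bundles using (_⇔_)
open import Relation.Nullary.Decidable using (⌊_⌋)
open import Relation.Binary.PropositionalEquality using (_≡_; _≢_)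

-- A configuration of n labelled tokens is a vector of cells; token i
-- (i : Fin n) sits at cell (lookup c i) = (column , row).
-- Configurations are taken up to translation; every finite configuration
-- in ℤ² has a translate in ℕ², so we use ℕ² coordinates and compare
-- configurations after normalising (translating the lower-left corner of
-- the bounding box to (0,0)).

Cell : Set
Cell = ℕ × ℕ

Config : ℕ → Set
Config n = Vec Cell n

Labelled : ∀ {n} → Config n → Set
Labelled c = ∀ i j → lookup c i ≡ lookup c j → i ≡ j

_≟c_ : (p q : Cell) → Bool
p ≟c q = ⌊ ≡-dec _≟ℕ_ _≟ℕ_ p q ⌋

occupied : ∀ {n} → Config n → Cell → Bool
occupied c p = any (λ q → p ≟c q) (toList c)

-- minimum / maximum of a vector of naturals (0 for the empty vector)
minV : ∀ {n} → Vec ℕ n → ℕ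
minV [] = 0
minV (x ∷ []) = x
minV (x ∷ y ∷ xs) = x ⊓ minV (y ∷ xs)

maxV : ∀ {n} → Vec ℕ n → ℕ
maxV [] = 0
maxV (x ∷ xs) = x ⊔ maxV xs

xs : ∀ {n} → Config n → Vec ℕ n
xs = map proj₁

ys : ∀ {n} → Config n → Vec ℕ n
ys = map proj₂

normalize : ∀ {n} → Config n → Config n
normalize c = map (λ p → (proj₁ p ∸ minV (xs c) , proj₂ p ∸ minV (ys c))) c

-- process column i (i ≥ 1): every token at (i,j) with (i-1,j) empty moves
-- to (i-1,j).  (Tokens of one column move horizontally in distinct rows,
-- so they can be treated simultaneously.)
stepCol : ∀ {n} → ℕ → Config n → Config n
stepCol i c = map f c
  where
  f : Cell → Cell
  f (x , y) = if (x ≡ᵇ i) ∧ not (occupied c (i ∸ 1 , y)) then (i ∸ 1 , y) else (x , y)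

pushLeft : ∀ {n} → Config n → Config n
pushLeft c = foldl (λ d i → stepCol (suc i) d) c₀ (upTo (maxV (xs c₀)))
  where c₀ = normalize c

reflectX : ∀ {n} → Config n → Config n
reflectX c = map (λ p → (maxV (xs c₀) ∸ proj₁ p , proj₂ p)) c₀
  where c₀ = normalize c

transpose : ∀ {n} → Config n → Config n
transpose = map (λ p → (proj₂ p , proj₁ p))

pushRight pushDown pushUp : ∀ {n} → Config n → Config n
pushRight c = reflectX (pushLeft (reflectX c))
pushDown c = transpose (pushLeft (transpose c))
pushUp c = transpose (pushRight (transpose c))

data Dir : Set where
  left right up down : Dir

push : ∀ {n} → Dir → Config n → Config n
push left = pushLeft
push right = pushRight
push up = pushUp
push down = pushDown

pushes : ∀ {n} → List Dir → Config n → Config n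
pushes [] c = c
pushes (d ∷ ds) c = pushes ds (push d c)

SameCells : ∀ {n} → Config n → Config n → Set
SameCells c d = ∀ p → (p ∈ normalize c) ⇔ (p ∈ normalize d)

Canonical : ∀ {n} → Config n → Set
Canonical c = SameCells (pushLeft c) c × SameCells (pushDown c) c

-- The group G_C: π (a permutation of tokens, equivalently of the occupied
-- cells of C, via token i ↦ cell of token i) belongs to G_C if some finite
-- sequence of pushes moves C (up to translation) to a configuration in
-- which the token originally at cell (c i) now sits at cell (c (π i)).
InG : ∀ {n} → Config n → Permutation′ n → Set
InG c π = ∃ λ ds → ∀ i →
  lookup (normalize (pushes ds c)) i ≡ lookup (normalize c) (π ⟨$⟩ʳ i)

width height : ∀ {n} → Config n → ℕ
width c = suc (maxV (xs (normalize c)))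
height c = suc (maxV (ys (normalize c)))

fullCol : ∀ {n} → Config n → ℕ → Bool
fullCol c x = all (λ y → occupied (normalize c) (x , y)) (upTo (height c))

fullRow : ∀ {n} → Config n → ℕ → Bool
fullRow c y = all (λ x → occupied (normalize c) (x , y)) (upTo (width c))

fullCols fullRows : ∀ {n} → Config n → ℕ
fullCols c = length (filter (λ x → fullCol c x Data.Bool.≟ true) (upTo (width c)))
fullRows c = length (filter (λ y → fullRow c y Data.Bool.≟ true) (upTo (height c)))

nonFullCols nonFullRows : ∀ {n} → Config n → ℕ
nonFullCols c = width c ∸ fullCols c
nonFullRows c = height c ∸ fullRows c

InCore : ∀ {n} → Config n → Cell → Set
InCore c (x , y) =
  nonFullCols c < fullCols c × nonFullRows c < fullRows c ×
  nonFullCols c ≤ x × x < width c ∸ nonFullCols c ×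
  nonFullRows c ≤ y × y < height c ∸ nonFullRows c

-- A canonical configuration is a Young diagram: with a′ full columns and b′ full rows in its
-- a × b bounding box, every row is an interval of length at least a′, every column one of
-- length at least b′, and no 2 × 2 window is occupied along exactly one diagonal.  These
-- properties, and with them the bounding box, are kept by every push.  A left push moves
-- exactly the rows whose first cell is empty; column 0 has length at least b′ in height b,
-- so it contains every row y with b ∸ b′ ≤ y < b′, and core tokens stay put.  Reflection and
-- transposition give the same for the other three pushes.  Hence every sequence of pushes
-- returns each core token to its own cell, and since tokens occupy distinct cells, a
-- permutation in G_C fixes the core tokens.
module Submission where

open import Defs
open import Data.Nat using (ℕ; zero; suc; _+_; _∸_; _≤_; _<_; _≡ᵇ_; _≤ᵇ_; z≤n; s≤s)
open import Data.Nat.Properties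
open import Data.Bool using (Bool; true; false; if_then_else_; _∧_; _∨_; not)
open import Data.Bool.Properties using (∨-zeroʳ; ¬-not; T-≡)
import Data.Bool.ListAction as ListAction
open import Data.Product using (_×_; _,_; proj₁; proj₂; ∃; swap)
open import Data.Product.Properties using (≡-dec)
open import Data.Sum using (_⊎_; inj₁; inj₂)
open import Data.Empty using (⊥; ⊥-elim)
open import Data.Fin using (Fin; zero; suc)
open import Data.Fin.Properties using (any?)
open import Data.Fin.Permutation using (Permutation′; _⟨$⟩ʳ_)
open import Data.Vec using (Vec; []; _∷_; lookup)
open import Data.Vec.Properties using (lookup-map; map-∘)
open import Data.Vec.Membership.Propositional using (_∈_)
open import Data.Vec.Membership.Propositional.Properties using (∈-lookup)
open import Data.Vec.Relation.Unary.Any using (here; there)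
open import Data.Vec.Relation.Binary.Pointwise.Extensional using (ext; Pointwise-≡⇒≡)
open import Data.List using (List; []; _∷_; foldl; upTo; filter; length; _∷ʳ_)
open import Data.List.Properties using (upTo-∷ʳ; foldl-∷ʳ; length-upTo; length-++; filter-++; length-filter)
open import Data.List.Membership.Propositional.Properties using (∈-upTo⁺; ∈-upTo⁻)
import Data.List.Relation.Unary.All as All
import Data.List.Relation.Unary.All.Properties as AllP
open import Function.Base using (case_of_)
open import Function.Bundles using (Equivalence)
open import Level using (0ℓ)
open import Relation.Nullary using (¬_; Dec; yes; no; contradiction)
open import Relation.Unary using (Pred; Decidable; _⊆′_; _≐′_; _∩_)
open import Relation.Unary.Properties using (≐′-sym; ≐′-trans)
open import Relation.Binary.Definitions using (tri<; tri≈; tri>)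
open import Relation.Binary.PropositionalEquality
  using (_≡_; _≢_; refl; sym; trans; cong; cong₂; subst; module ≡-Reasoning)

-- Occupancy and normalisation

Occupied : ∀ {n} → Config n → Cell → Set
Occupied v p = ∃ λ j → lookup v j ≡ p

occupied? : ∀ {n} (v : Config n) p → Dec (Occupied v p)
occupied? v p = any? (λ j → ≡-dec _≟_ _≟_ (lookup v j) p)

occupied⇒Occupied : ∀ {n} (v : Config n) p → occupied v p ≡ true → Occupied v p
occupied⇒Occupied (q ∷ v) p h with ≡-dec _≟_ _≟_ p q
... | yes p≡q = zero , sym p≡q
... | no _ with occupied⇒Occupied v p h
...   | j , vj≡p = suc j , vj≡p

Occupied⇒occupied : ∀ {n} (v : Config n) p → Occupied v p → occupied v p ≡ true
Occupied⇒occupied (q ∷ v) p (j , vj≡p) with ≡-dec _≟_ _≟_ p q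
... | yes _ = refl
Occupied⇒occupied (q ∷ v) p (zero , q≡p) | no p≢q = contradiction (sym q≡p) p≢q
Occupied⇒occupied (q ∷ v) p (suc j , vj≡p) | no _ = Occupied⇒occupied v p (j , vj≡p)

¬Occupied⇒occupied≡false : ∀ {n} (v : Config n) p → ¬ Occupied v p → occupied v p ≡ false
¬Occupied⇒occupied≡false v p ¬o = ¬-not (λ o → ¬o (occupied⇒Occupied v p o))

occupied≡false⇒¬Occupied : ∀ {n} (v : Config n) p → occupied v p ≡ false → ¬ Occupied v p
occupied≡false⇒¬Occupied v p f o with () ← trans (sym (Occupied⇒occupied v p o)) f

∈⇒Occupied : ∀ {n} (v : Config n) p → p ∈ v → Occupied v p
∈⇒Occupied (q ∷ v) p (here p≡q) = zero , sym p≡q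
∈⇒Occupied (q ∷ v) p (there p∈v) with ∈⇒Occupied v p p∈v
... | j , vj≡p = suc j , vj≡p

Occupied⇒∈ : ∀ {n} (v : Config n) p → Occupied v p → p ∈ v
Occupied⇒∈ v p (j , vj≡p) = subst (_∈ v) vj≡p (∈-lookup j v)

minV≤lookup : ∀ {n} (v : Vec ℕ n) j → minV v ≤ lookup v j
minV≤lookup (x ∷ []) zero = ≤-refl
minV≤lookup (x ∷ y ∷ v) zero = m⊓n≤m x _
minV≤lookup (x ∷ y ∷ v) (suc j) = ≤-trans (m⊓n≤n x _) (minV≤lookup (y ∷ v) j)

minV-attained : ∀ {n} (v : Vec ℕ (suc n)) → ∃ λ j → lookup v j ≡ minV v
minV-attained (x ∷ []) = zero , refl
minV-attained (x ∷ y ∷ v) with ⊓-sel x (minV (y ∷ v)) | minV-attained (y ∷ v)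
... | inj₁ x⊓m≡x | _ = zero , sym x⊓m≡x
... | inj₂ x⊓m≡m | j , vj≡m = suc j , trans vj≡m (sym x⊓m≡m)

minV≡0 : ∀ {n} (v : Vec ℕ n) j → lookup v j ≡ 0 → minV v ≡ 0
minV≡0 v j vj≡0 = n≤0⇒n≡0 (subst (minV v ≤_) vj≡0 (minV≤lookup v j))

lookup≤maxV : ∀ {n} (v : Vec ℕ n) j → lookup v j ≤ maxV v
lookup≤maxV (x ∷ v) zero = m≤m⊔n x _
lookup≤maxV (x ∷ v) (suc j) = ≤-trans (lookup≤maxV v j) (m≤n⊔m x _)

maxV-lub : ∀ {n} (v : Vec ℕ n) m → (∀ j → lookup v j ≤ m) → maxV v ≤ m
maxV-lub [] m _ = z≤n
maxV-lub (x ∷ v) m v≤m = ⊔-lub (v≤m zero) (maxV-lub v m (λ j → v≤m (suc j)))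

maxV-attained⇒≡ : ∀ {n} (v : Vec ℕ n) m → (∀ j → lookup v j ≤ m) → (∃ λ j → lookup v j ≡ m) →
  maxV v ≡ m
maxV-attained⇒≡ v m v≤m (j , vj≡m) = ≤-antisym (maxV-lub v m v≤m) (subst (_≤ maxV v) vj≡m (lookup≤maxV v j))

lookup-xs : ∀ {n} (v : Config n) j → lookup (xs v) j ≡ proj₁ (lookup v j)
lookup-xs v j = lookup-map j proj₁ v

lookup-ys : ∀ {n} (v : Config n) j → lookup (ys v) j ≡ proj₂ (lookup v j)
lookup-ys v j = lookup-map j proj₂ v

lookup-normalize : ∀ {n} (v : Config n) j →
  lookup (normalize v) j ≡ (proj₁ (lookup v j) ∸ minV (xs v) , proj₂ (lookup v j) ∸ minV (ys v))
lookup-normalize v j = lookup-map j _ v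

normalize-fixed : ∀ {n} (v : Config n) →
  (∃ λ j → proj₁ (lookup v j) ≡ 0) → (∃ λ j → proj₂ (lookup v j) ≡ 0) → normalize v ≡ v
normalize-fixed v (j₁ , x≡0) (j₂ , y≡0) = Pointwise-≡⇒≡ (ext fixed)
  where
  fixed : ∀ j → lookup (normalize v) j ≡ lookup v j
  fixed j rewrite lookup-normalize v j
                | minV≡0 (xs v) j₁ (trans (lookup-xs v j₁) x≡0)
                | minV≡0 (ys v) j₂ (trans (lookup-ys v j₂) y≡0) = refl

normalize-touches-x0 : ∀ {n} (c : Config (suc n)) → ∃ λ j → proj₁ (lookup (normalize c) j) ≡ 0
normalize-touches-x0 c with minV-attained (xs c)
... | j , xj≡min = j , trans (cong proj₁ (lookup-normalize c j))
                         (trans (cong (_∸ minV (xs c)) (trans (sym (lookup-xs c j)) xj≡min)) (n∸n≡0 (minV (xs c))))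

normalize-touches-y0 : ∀ {n} (c : Config (suc n)) → ∃ λ j → proj₂ (lookup (normalize c) j) ≡ 0
normalize-touches-y0 c with minV-attained (ys c)
... | j , yj≡min = j , trans (cong proj₂ (lookup-normalize c j))
                         (trans (cong (_∸ minV (ys c)) (trans (sym (lookup-ys c j)) yj≡min)) (n∸n≡0 (minV (ys c))))

normalize-injective : ∀ {n} (c : Config n) j k →
  lookup (normalize c) j ≡ lookup (normalize c) k → lookup c j ≡ lookup c k
normalize-injective c j k e = cong₂ _,_
  (∸-cancelʳ-≡ (minX≤ j) (minX≤ k)
    (trans (sym (cong proj₁ (lookup-normalize c j))) (trans (cong proj₁ e) (cong proj₁ (lookup-normalize c k)))))
  (∸-cancelʳ-≡ (minY≤ j) (minY≤ k)
    (trans (sym (cong proj₂ (lookup-normalize c j))) (trans (cong proj₂ e) (cong proj₂ (lookup-normalize c k)))))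
  where
  minX≤ : ∀ i → minV (xs c) ≤ proj₁ (lookup c i)
  minX≤ i = subst (minV (xs c) ≤_) (lookup-xs c i) (minV≤lookup (xs c) i)
  minY≤ : ∀ i → minV (ys c) ≤ proj₂ (lookup c i)
  minY≤ i = subst (minV (ys c) ≤_) (lookup-ys c i) (minV≤lookup (ys c) i)

-- The sweep performed by pushLeft

≤⇒≤ᵇ≡true : ∀ {m n} → m ≤ n → (m ≤ᵇ n) ≡ true
≤⇒≤ᵇ≡true m≤n = Equivalence.to T-≡ (≤⇒≤ᵇ m≤n)

>⇒≤ᵇ≡false : ∀ {m n} → n < m → (m ≤ᵇ n) ≡ false
>⇒≤ᵇ≡false {m} {n} n<m = ¬-not (λ e → <⇒≱ n<m (≤ᵇ⇒≤ m n (Equivalence.from T-≡ e)))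

≡ᵇ-refl : ∀ m → (m ≡ᵇ m) ≡ true
≡ᵇ-refl m = Equivalence.to T-≡ (≡⇒≡ᵇ m m refl)

≢⇒≡ᵇ≡false : ∀ {m n} → m ≢ n → (m ≡ᵇ n) ≡ false
≢⇒≡ᵇ≡false {m} {n} m≢n = ¬-not (λ e → m≢n (≡ᵇ⇒≡ m n (Equivalence.from T-≡ e)))

stepCell : ℕ → ∀ {n} → Config n → Cell → Cell
stepCell i e (x , y) = if (x ≡ᵇ i) ∧ not (occupied e (i ∸ 1 , y)) then (i ∸ 1 , y) else (x , y)

stepCol-lookup : ∀ {n} i (e : Config n) j → lookup (stepCol i e) j ≡ stepCell i e (lookup e j)
stepCol-lookup i e j = lookup-map j (stepCell i e) e

-- pushLeft processes columns 1, 2, … in turn; sweep k is the position of a token of d once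
-- columns up to k are done.  At the end a token has moved one step left exactly when its
-- row has an empty cell somewhere to its left.
module Sweep {n} (d : Config n) where

  hasGap : ℕ → ℕ → Bool
  hasGap y zero = false
  hasGap y (suc x) = hasGap y x ∨ not (occupied d (x , y))

  hasGap⇒empty : ∀ y x → hasGap y x ≡ true → ∃ λ h → h < x × ¬ Occupied d (h , y)
  hasGap⇒empty y (suc x) gap with hasGap y x in gap′ | occupied d (x , y) in occ
  ... | true | _ = let (h , h<x , ¬o) = hasGap⇒empty y x gap′ in h , <-trans h<x (n<1+n x) , ¬o
  ... | false | false = x , ≤-refl , occupied≡false⇒¬Occupied d _ occ

  empty⇒hasGap : ∀ y x h → h < x → ¬ Occupied d (h , y) → hasGap y x ≡ true
  empty⇒hasGap y (suc x) h h<x+1 ¬o with h ≟ x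
  ... | yes refl rewrite ¬Occupied⇒occupied≡false d _ ¬o = ∨-zeroʳ (hasGap y h)
  ... | no h≢x rewrite empty⇒hasGap y x h (≤∧≢⇒< (≤-pred h<x+1) h≢x) ¬o = refl

  pushLeftCell : Cell → Cell
  pushLeftCell (x , y) = if hasGap y x then (x ∸ 1 , y) else (x , y)

  sweep : ℕ → Cell → Cell
  sweep k (x , y) = if (x ≤ᵇ k) ∧ hasGap y x then (x ∸ 1 , y) else (x , y)

  sweep-zero : ∀ p → sweep 0 p ≡ p
  sweep-zero (zero , y) = refl
  sweep-zero (suc x , y) = refl

  sweep-within : ∀ k x y → x ≤ k → sweep k (x , y) ≡ pushLeftCell (x , y)
  sweep-within k x y x≤k rewrite ≤⇒≤ᵇ≡true x≤k = refl

  sweep-onto-column : ∀ k x y y′ → sweep k (x , y) ≡ (k , y′) → (x , y) ≡ (k , y′) × hasGap y x ≡ false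
  sweep-onto-column k zero y y′ eq = eq , refl
  sweep-onto-column k (suc x) y y′ eq with suc x ≤? k
  ... | no x≰k rewrite >⇒≤ᵇ≡false (≰⇒> x≰k) = contradiction (≤-reflexive (cong proj₁ eq)) x≰k
  ... | yes x<k rewrite ≤⇒≤ᵇ≡true x<k with hasGap y (suc x)
  ...   | false = eq , refl
  ...   | true = contradiction (subst (suc x ≤_) (sym (cong proj₁ eq)) x<k) (<-irrefl refl)

  module AfterColumns (k : ℕ) (e : Config n) (e≡ : ∀ j → lookup e j ≡ sweep k (lookup d j)) where

    column-k→ : ∀ y → Occupied e (k , y) → Occupied d (k , y) × hasGap y k ≡ false
    column-k→ y (j , ej≡) with lookup d j in dj≡
    ... | (x , y′) with sweep-onto-column k x y′ y (trans (sym (trans (e≡ j) (cong (sweep k) dj≡))) ej≡)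
    ...   | refl , noGap = (j , dj≡) , noGap

    column-k← : ∀ y → Occupied d (k , y) → hasGap y k ≡ false → Occupied e (k , y)
    column-k← y (j , dj≡) noGap = j , trans (e≡ j) (trans (cong (sweep k) dj≡) fixed)
      where
      fixed : sweep k (k , y) ≡ (k , y)
      fixed rewrite ≤⇒≤ᵇ≡true {k} ≤-refl | noGap = refl

    occupied-column-k : ∀ y → occupied e (k , y) ≡ not (hasGap y k) ∧ occupied d (k , y)
    occupied-column-k y with occupied? e (k , y)
    ... | yes o with column-k→ y o
    ...   | od , noGap rewrite noGap | Occupied⇒occupied d _ od = Occupied⇒occupied e _ o
    occupied-column-k y | no ¬o with hasGap y k in gap | occupied? d (k , y)
    ... | true | _ = ¬Occupied⇒occupied≡false e _ ¬o
    ... | false | yes od = contradiction (column-k← y od gap) ¬o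
    ... | false | no ¬od rewrite ¬Occupied⇒occupied≡false d _ ¬od = ¬Occupied⇒occupied≡false e _ ¬o

    step-before : ∀ x y → x ≤ k → stepCell (suc k) e (sweep k (x , y)) ≡ sweep (suc k) (x , y)
    step-before x y x≤k rewrite ≤⇒≤ᵇ≡true x≤k | ≤⇒≤ᵇ≡true (m≤n⇒m≤1+n x≤k) with hasGap y x
    ... | true rewrite ≢⇒≡ᵇ≡false (<⇒≢ (≤-<-trans (m∸n≤m x 1) (s≤s x≤k))) = refl
    ... | false rewrite ≢⇒≡ᵇ≡false (<⇒≢ (s≤s x≤k)) = refl

    step-at : ∀ y → stepCell (suc k) e (sweep k (suc k , y)) ≡ sweep (suc k) (suc k , y)
    step-at y rewrite >⇒≤ᵇ≡false {suc k} {k} ≤-refl | ≡ᵇ-refl (suc k) | ≤⇒≤ᵇ≡true {suc k} ≤-refl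
                    | occupied-column-k y with hasGap y k | occupied d (k , y)
    ... | true | _ = refl
    ... | false | true = refl
    ... | false | false = refl

    step-after : ∀ x y → suc k < x → stepCell (suc k) e (sweep k (x , y)) ≡ sweep (suc k) (x , y)
    step-after x y k<x rewrite >⇒≤ᵇ≡false {x} {k} (<-trans (n<1+n k) k<x) | >⇒≤ᵇ≡false k<x
                             | ≢⇒≡ᵇ≡false (>⇒≢ k<x) = refl

    step : ∀ j → lookup (stepCol (suc k) e) j ≡ sweep (suc k) (lookup d j)
    step j rewrite stepCol-lookup (suc k) e j | e≡ j with lookup d j
    ... | (x , y) with <-cmp x (suc k)
    ...   | tri< x<k _ _ = step-before x y (≤-pred x<k)
    ...   | tri≈ _ refl _ = step-at y
    ...   | tri> _ _ k<x = step-after x y k<x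

  sweepColumns : List ℕ → Config n
  sweepColumns = foldl (λ d′ i → stepCol (suc i) d′) d

  lookup-sweepColumns : ∀ m j → lookup (sweepColumns (upTo m)) j ≡ sweep m (lookup d j)
  lookup-sweepColumns zero j = sym (sweep-zero _)
  lookup-sweepColumns (suc m) j = begin
    lookup (sweepColumns (upTo (suc m))) j
      ≡⟨ cong (λ l → lookup (sweepColumns l) j) (sym (upTo-∷ʳ m)) ⟩
    lookup (sweepColumns (upTo m ∷ʳ m)) j
      ≡⟨ cong (λ v → lookup v j) (foldl-∷ʳ _ d m (upTo m)) ⟩
    lookup (stepCol (suc m) (sweepColumns (upTo m))) j
      ≡⟨ AfterColumns.step m (sweepColumns (upTo m)) (lookup-sweepColumns m) j ⟩
    sweep (suc m) (lookup d j) ∎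
    where open ≡-Reasoning

lookup-pushLeft : ∀ {n} (c : Config n) j →
  lookup (pushLeft c) j ≡ Sweep.pushLeftCell (normalize c) (lookup (normalize c) j)
lookup-pushLeft c j = trans (Sweep.lookup-sweepColumns d (maxV (xs d)) j)
  (Sweep.sweep-within d _ _ _ (subst (_≤ maxV (xs d)) (lookup-xs d j) (lookup≤maxV (xs d) j)))
  where d = normalize c

-- Mirror images and intervals

-- x̄ = a ∸ 1 ∸ x, stated without truncated subtraction
record Mirror (a x x̄ : ℕ) : Set where
  constructor mirror
  field
    sum≡ : suc (x + x̄) ≡ a

open Mirror

mirror-sym : ∀ {a x x̄} → Mirror a x x̄ → Mirror a x̄ x
mirror-sym {x = x} {x̄} (mirror m) = mirror (trans (cong suc (+-comm x̄ x)) m)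

mirror-unique : ∀ {a x x̄ x̄′} → Mirror a x x̄ → Mirror a x x̄′ → x̄ ≡ x̄′
mirror-unique {x = x} (mirror m) (mirror m′) = +-cancelˡ-≡ x _ _ (suc-injective (trans m (sym m′)))

mirror-of : ∀ {a x} → x < a → Mirror a x (a ∸ suc x)
mirror-of x<a = mirror (m+[n∸m]≡n x<a)

mirror⇒< : ∀ {a x x̄} → Mirror a x x̄ → x < a
mirror⇒< {x = x} {x̄} (mirror m) = subst (x <_) m (s≤s (m≤m+n x x̄))

mirror-≤⇒< : ∀ {a x x̄ s} → Mirror a x x̄ → s ≤ x̄ → x + s < a
mirror-≤⇒< {x = x} (mirror m) s≤x̄ = subst (_ <_) m (s≤s (+-monoʳ-≤ x s≤x̄))

mirror-<⇒≤ : ∀ {a x x̄ s} → Mirror a x x̄ → x + s < a → s ≤ x̄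
mirror-<⇒≤ {x = x} (mirror m) x+s<a = +-cancelˡ-≤ x _ _ (≤-pred (subst (_ <_) (sym m) x+s<a))

-- P is the interval [lo , a ∸ hi) and has at least ℓ elements.
record Interval (a ℓ : ℕ) (P : ℕ → Set) : Set where
  constructor interval
  field
    lo hi : ℕ
    long : lo + ℓ + hi ≤ a
    bounded : ∀ x → P x → lo ≤ x × x + hi < a
    filled : ∀ x → lo ≤ x → x + hi < a → P x

open Interval

module _ {a ℓ : ℕ} {P : Pred ℕ 0ℓ} where

  Interval-resp : ∀ {Q} → P ≐′ Q → Interval a ℓ P → Interval a ℓ Q
  Interval-resp (P⇒Q , Q⇒P) (interval lo hi long bounded filled) =
    interval lo hi long (λ x q → bounded x (Q⇒P x q)) (λ x lo≤x x<hi → P⇒Q x (filled x lo≤x x<hi))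

  lo+hi<a : 0 < ℓ → (I : Interval a ℓ P) → lo I + hi I < a
  lo+hi<a 0<ℓ I =
    <-≤-trans (+-monoˡ-≤ (hi I) (subst (_≤ lo I + ℓ) (+-comm (lo I) 1) (+-monoʳ-≤ (lo I) 0<ℓ))) (long I)

  Interval-lo : 0 < ℓ → (I : Interval a ℓ P) → P (lo I)
  Interval-lo 0<ℓ I = filled I (lo I) ≤-refl (lo+hi<a 0<ℓ I)

  Interval-top : 0 < ℓ → (I : Interval a ℓ P) → ∃ λ y → Mirror a y (hi I) × lo I ≤ y × P y
  Interval-top 0<ℓ I = a ∸ suc (hi I) , top-mirror , lo≤top , filled I _ lo≤top (≤-reflexive (sum≡ top-mirror))
    where
    hi<a : hi I < a
    hi<a = ≤-<-trans (m≤n+m (hi I) (lo I)) (lo+hi<a 0<ℓ I)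
    top-mirror : Mirror a (a ∸ suc (hi I)) (hi I)
    top-mirror = mirror-sym (mirror-of hi<a)
    lo≤top : lo I ≤ a ∸ suc (hi I)
    lo≤top = mirror-<⇒≤ (mirror-of hi<a) (subst (_< a) (+-comm (lo I) (hi I)) (lo+hi<a 0<ℓ I))

  Interval-⊆ : ∀ {m Q} (I : Interval a ℓ P) (J : Interval a m Q) → lo J ≤ lo I → hi J ≤ hi I → P ⊆′ Q
  Interval-⊆ I J loJ≤loI hiJ≤hiI x px =
    filled J x (≤-trans loJ≤loI lo≤x) (≤-<-trans (+-monoʳ-≤ x hiJ≤hiI) x+hi<a)
    where
    lo≤x = proj₁ (bounded I x px)
    x+hi<a = proj₂ (bounded I x px)

  Interval-convex : Interval a ℓ P → ∀ {x₁ x₂} x → P x₁ → P x₂ → x₁ ≤ x → x ≤ x₂ → P x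
  Interval-convex I x px₁ px₂ x₁≤x x≤x₂ =
    filled I x (≤-trans (proj₁ (bounded I _ px₁)) x₁≤x)
      (≤-<-trans (+-monoˡ-≤ (hi I) x≤x₂) (proj₂ (bounded I _ px₂)))

  Interval-central : Interval a ℓ P → ∀ x → a ≤ x + ℓ → x < ℓ → P x
  Interval-central I x a≤x+ℓ x<ℓ = filled I x lo≤x (<-≤-trans (+-monoˡ-< (hi I) x<ℓ) ℓ+hi≤a)
    where
    ℓ+hi≤a : ℓ + hi I ≤ a
    ℓ+hi≤a = ≤-trans (+-monoˡ-≤ (hi I) (m≤n+m ℓ (lo I))) (long I)
    lo≤x : lo I ≤ x
    lo≤x = +-cancelʳ-≤ ℓ (lo I) x (≤-trans (≤-trans (m≤m+n (lo I + ℓ) (hi I)) (long I)) a≤x+ℓ)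

  Interval-reflect : Interval a ℓ P → Interval a ℓ (λ x → ∃ λ x̄ → Mirror a x x̄ × P x̄)
  Interval-reflect (interval lo hi long bounded filled) = interval hi lo long′
    (λ { x (x̄ , m , px̄) →
           mirror-<⇒≤ (mirror-sym m) (proj₂ (bounded x̄ px̄)) , mirror-≤⇒< m (proj₁ (bounded x̄ px̄)) })
    (λ x hi≤x x+lo<a → let m = mirror-of (≤-<-trans (m≤m+n x lo) x+lo<a) in
       _ , m , filled _ (mirror-<⇒≤ m x+lo<a) (mirror-≤⇒< (mirror-sym m) hi≤x))
    where
    long′ : hi + ℓ + lo ≤ a
    long′ = subst (_≤ a)
      (trans (+-comm (lo + ℓ) hi) (trans (cong (hi +_) (+-comm lo ℓ)) (sym (+-assoc hi ℓ lo)))) long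

  Interval-suc : 0 < ℓ → ¬ P 0 → Interval a ℓ P → Interval a ℓ (λ x → P (suc x))
  Interval-suc 0<ℓ ¬p0 I@(interval zero _ _ _ _) = contradiction (Interval-lo 0<ℓ I) ¬p0
  Interval-suc 0<ℓ ¬p0 (interval (suc lo) hi long bounded filled) = interval lo (suc hi)
    (subst (_≤ a) (sym (+-suc (lo + ℓ) hi)) long)
    (λ x px → let (lo<x , x+hi<a) = bounded (suc x) px in ≤-pred lo<x , subst (_< a) (sym (+-suc x hi)) x+hi<a)
    (λ x lo≤x x+hi<a → filled (suc x) (s≤s lo≤x) (subst (_< a) (+-suc x hi) x+hi<a))

module _ {P : Pred ℕ 0ℓ} (P? : Decidable P) where

  lastOfRun : ∀ B → (∀ x → P x → x < B) → ∀ x → P x → ∃ λ m → x ≤ m × P m × ¬ P (suc m)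
  lastOfRun B bounded x px = run B x (m≤n+m B x) px
    where
    run : ∀ fuel x → B ≤ x + fuel → P x → ∃ λ m → x ≤ m × P m × ¬ P (suc m)
    run zero x B≤x px = contradiction (bounded x px) (≤⇒≯ (subst (B ≤_) (+-identityʳ x) B≤x))
    run (suc fuel) x B≤x+fuel px with P? (suc x)
    ... | no ¬px′ = x , ≤-refl , px , ¬px′
    ... | yes px′ with run fuel (suc x) (subst (B ≤_) (+-suc x fuel) B≤x+fuel) px′
    ...   | m , x<m , pm , ¬pm′ = m , <⇒≤ x<m , pm , ¬pm′

  count≤ : ∀ W r → (∀ z → z < W → P z → z < r) → length (filter P? (upTo W)) ≤ r
  count≤ zero r _ = z≤n
  count≤ (suc W) r below = subst (λ l → length (filter P? l) ≤ r) (upTo-∷ʳ W) count≤-snoc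
    where
    count≤W : length (filter P? (upTo W)) ≤ W
    count≤W = subst (length (filter P? (upTo W)) ≤_) (length-upTo W) (length-filter P? (upTo W))
    count≤-snoc : length (filter P? (upTo W ∷ʳ W)) ≤ r
    count≤-snoc rewrite filter-++ P? (upTo W) (W ∷ []) | length-++ (filter P? (upTo W)) {filter P? (W ∷ [])}
      with P? W
    ... | yes pW = subst (_≤ r) (+-comm 1 _) (≤-trans (s≤s count≤W) (below W (n<1+n W) pW))
    ... | no _ = subst (_≤ r) (sym (+-identityʳ _)) (count≤ W r (λ z z<W → below z (<-trans z<W (n<1+n W))))

  initialSegment : (∀ {x x′} → P x → x′ ≤ x → P x′) → ∀ B → (∀ x → P x → x < B) →
    ∃ λ e → e ≤ B × (∀ x → P x → x < e) × (∀ x → x < e → P x)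
  initialSegment closed zero bounded = 0 , z≤n , bounded , λ _ ()
  initialSegment closed (suc B) bounded with P? B
  ... | yes pB = suc B , ≤-refl , bounded , λ x x<B+1 → closed pB (≤-pred x<B+1)
  ... | no ¬pB with initialSegment closed B (λ x px → ≤∧≢⇒< (≤-pred (bounded x px)) (λ { refl → ¬pB px }))
  ...   | e , e≤B , below , upto = e , m≤n⇒m≤1+n e≤B , below , upto

  downClosed⇒Interval : ∀ {a ℓ} → (∀ {x x′} → P x → x′ ≤ x → P x′) →
    (∀ x → P x → x < a) → (∀ x → x < ℓ → P x) → Interval a ℓ P
  downClosed⇒Interval {a} {ℓ} closed bounded full with initialSegment closed a bounded
  ... | e , e≤a , below , upto = interval 0 (a ∸ e)
          (subst (ℓ + (a ∸ e) ≤_) e+[a∸e]≡a (+-monoˡ-≤ (a ∸ e) ℓ≤e))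
          (λ x px → z≤n , subst (x + (a ∸ e) <_) e+[a∸e]≡a (+-monoˡ-< (a ∸ e) (below x px)))
          (λ x _ x+[a∸e]<a →
             upto x (+-cancelʳ-< (a ∸ e) x e (subst (x + (a ∸ e) <_) (sym e+[a∸e]≡a) x+[a∸e]<a)))
    where
    e+[a∸e]≡a : e + (a ∸ e) ≡ a
    e+[a∸e]≡a = m+[n∸m]≡n e≤a
    ℓ≤e : ℓ ≤ e
    ℓ≤e with ℓ ≤? e
    ... | yes ℓ≤e = ℓ≤e
    ... | no ℓ≰e = contradiction (below e (full e (≰⇒> ℓ≰e))) (<-irrefl refl)

-- Admissible occupancy patterns

Pattern : Set₁
Pattern = ℕ → ℕ → Set

record Admissible (a b a′ b′ : ℕ) (O : Pattern) : Set where
  field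
    row : ∀ y → y < b → Interval a a′ (λ x → O x y)
    column : ∀ x → x < a → Interval b b′ (O x)
    no-crossing : ∀ x₁ y₁ x₂ y₂ → ¬ O x₁ y₁ → ¬ O x₂ y₂ → O x₁ y₂ → O x₂ y₁ → ⊥
    x-bound : ∀ x y → O x y → x < a
    y-bound : ∀ x y → O x y → y < b

open Admissible

ReflectX : ℕ → Pattern → Pattern
ReflectX a O x y = ∃ λ x̄ → Mirror a x x̄ × O x̄ y

module _ {a b a′ b′ : ℕ} {O : Pattern} where

  Admissible-resp : ∀ {O′ : Pattern} → (∀ x y → O x y → O′ x y) → (∀ x y → O′ x y → O x y) →
    Admissible a b a′ b′ O → Admissible a b a′ b′ O′
  Admissible-resp O⇒O′ O′⇒O A .row y y<b =
    Interval-resp ((λ x → O⇒O′ x y) , (λ x → O′⇒O x y)) (A .row y y<b)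
  Admissible-resp O⇒O′ O′⇒O A .column x x<a = Interval-resp (O⇒O′ x , O′⇒O x) (A .column x x<a)
  Admissible-resp O⇒O′ O′⇒O A .no-crossing x₁ y₁ x₂ y₂ ¬o₁ ¬o₂ o₁ o₂ =
    A .no-crossing x₁ y₁ x₂ y₂ (λ o → ¬o₁ (O⇒O′ _ _ o)) (λ o → ¬o₂ (O⇒O′ _ _ o))
      (O′⇒O _ _ o₁) (O′⇒O _ _ o₂)
  Admissible-resp O⇒O′ O′⇒O A .x-bound x y o = A .x-bound x y (O′⇒O x y o)
  Admissible-resp O⇒O′ O′⇒O A .y-bound x y o = A .y-bound x y (O′⇒O x y o)

  Admissible-transpose : Admissible a b a′ b′ O → Admissible b a b′ a′ (λ x y → O y x)
  Admissible-transpose A .row y y<a = A .column y y<a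
  Admissible-transpose A .column x x<b = A .row x x<b
  Admissible-transpose A .no-crossing x₁ y₁ x₂ y₂ ¬o₁ ¬o₂ o₁ o₂ =
    A .no-crossing y₁ x₁ y₂ x₂ ¬o₁ ¬o₂ o₂ o₁
  Admissible-transpose A .x-bound x y o = A .y-bound y x o
  Admissible-transpose A .y-bound x y o = A .x-bound y x o

  Admissible-reflectX : Admissible a b a′ b′ O → Admissible a b a′ b′ (ReflectX a O)
  Admissible-reflectX A .row y y<b = Interval-reflect (A .row y y<b)
  Admissible-reflectX A .column x x<a = Interval-resp
    ((λ y o → _ , m , o) , λ { y (x̄′ , m′ , o) → subst (λ z → O z y) (mirror-unique m′ m) o })
    (A .column _ (mirror⇒< (mirror-sym m)))
    where m = mirror-of x<a
  Admissible-reflectX A .no-crossing x₁ y₁ x₂ y₂ ¬o₁ ¬o₂ (x̄₁ , m₁ , o₁) (x̄₂ , m₂ , o₂) =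
    A .no-crossing x̄₁ y₁ x̄₂ y₂ (λ o → ¬o₁ (x̄₁ , m₁ , o)) (λ o → ¬o₂ (x̄₂ , m₂ , o)) o₁ o₂
  Admissible-reflectX A .x-bound x y (x̄ , m , o) = mirror⇒< m
  Admissible-reflectX A .y-bound x y (x̄ , m , o) = A .y-bound x̄ y o

  Admissible-row-convex : Admissible a b a′ b′ O →
    ∀ {x₁ x₂} x y → O x₁ y → O x₂ y → x₁ ≤ x → x ≤ x₂ → O x y
  Admissible-row-convex A x y o₁ = Interval-convex (A .row y (A .y-bound _ y o₁)) x o₁

  columns-nested : 0 < b′ → Admissible a b a′ b′ O →
    ∀ {x₁ x₂} → x₁ < a → x₂ < a → O x₁ ⊆′ O x₂ ⊎ O x₂ ⊆′ O x₁
  columns-nested 0<b′ A {x₁} {x₂} x₁<a x₂<a = nested (A .column x₁ x₁<a) (A .column x₂ x₂<a)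
    where
    crossing : ∀ {x x′} (I : Interval b b′ (O x)) (I′ : Interval b b′ (O x′)) →
      lo I < lo I′ → hi I′ < hi I → ⊥
    crossing {x} {x′} I I′ lo<lo′ hi′<hi with Interval-top 0<b′ I′
    ... | top , m , _ , o′ = A .no-crossing x top x′ (lo I)
          (λ o → <⇒≱ hi′<hi (mirror-<⇒≤ m (proj₂ (bounded I top o))))
          (λ o → <⇒≱ lo<lo′ (proj₁ (bounded I′ (lo I) o)))
          (Interval-lo 0<b′ I) o′
    nested : Interval b b′ (O x₁) → Interval b b′ (O x₂) → O x₁ ⊆′ O x₂ ⊎ O x₂ ⊆′ O x₁
    nested I₁ I₂ with lo I₂ ≤? lo I₁ | hi I₂ ≤? hi I₁
    ... | yes lo₂≤lo₁ | yes hi₂≤hi₁ = inj₁ (Interval-⊆ I₁ I₂ lo₂≤lo₁ hi₂≤hi₁)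
    ... | no lo₂≰lo₁ | no hi₂≰hi₁ =
      inj₂ (Interval-⊆ I₂ I₁ (<⇒≤ (≰⇒> lo₂≰lo₁)) (<⇒≤ (≰⇒> hi₂≰hi₁)))
    ... | yes lo₂≤lo₁ | no hi₂≰hi₁ with lo I₁ ≤? lo I₂
    ...   | yes lo₁≤lo₂ = inj₂ (Interval-⊆ I₂ I₁ lo₁≤lo₂ (<⇒≤ (≰⇒> hi₂≰hi₁)))
    ...   | no lo₁≰lo₂ = ⊥-elim (crossing I₂ I₁ (≰⇒> lo₁≰lo₂) (≰⇒> hi₂≰hi₁))
    nested I₁ I₂ | no lo₂≰lo₁ | yes hi₂≤hi₁ with hi I₁ ≤? hi I₂
    ...   | yes hi₁≤hi₂ = inj₂ (Interval-⊆ I₂ I₁ (<⇒≤ (≰⇒> lo₂≰lo₁)) hi₁≤hi₂)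
    ...   | no hi₁≰hi₂ = ⊥-elim (crossing I₁ I₂ (≰⇒> lo₂≰lo₁) (≰⇒> hi₁≰hi₂))

-- A left push seen on occupancy: a row whose first cell is empty moves one step left.
ShiftLeft : Pattern → Pattern
ShiftLeft O x y = (O 0 y × O x y) ⊎ (¬ O 0 y × O (suc x) y)

module _ {a b a′ b′ : ℕ} {O : Pattern} (O? : ∀ x y → Dec (O x y)) (0<a′ : 0 < a′) (0<b′ : 0 < b′)
  (A : Admissible a b a′ b′ O) where

  private
    shifted-column-suc : ∀ x → O 0 ⊆′ O (suc x) → ShiftLeft O x ≐′ O (suc x)
    shifted-column-suc x col₀⊆ = (λ { y (inj₁ (o₀ , _)) → col₀⊆ y o₀ ; y (inj₂ (_ , o)) → o }) , into
      where
      into : O (suc x) ⊆′ ShiftLeft O x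
      into y o with O? 0 y
      ... | yes o₀ = inj₁ (o₀ , Admissible-row-convex A x y o₀ o z≤n (n≤1+n x))
      ... | no ¬o₀ = inj₂ (¬o₀ , o)

    shifted-column-meet : ∀ x → O (suc x) ⊆′ O 0 → ShiftLeft O x ≐′ (O 0 ∩ O x)
    shifted-column-meet x ⊆col₀ =
      (λ { y (inj₁ o) → o ; y (inj₂ (¬o₀ , o)) → contradiction (⊆col₀ y o) ¬o₀ }) , (λ y o → inj₁ o)

    shifted-column-within : ∀ x → x < a → O (suc x) ⊆′ O 0 → ∃ λ x* → x* < a × ShiftLeft O x ≐′ O x*
    shifted-column-within x x<a ⊆col₀ with columns-nested 0<b′ A (≤-<-trans z≤n x<a) x<a
    ... | inj₁ col₀⊆colₓ = 0 , ≤-<-trans z≤n x<a ,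
      ≐′-trans (shifted-column-meet x ⊆col₀) ((λ _ → proj₁) , λ y o → o , col₀⊆colₓ y o)
    ... | inj₂ colₓ⊆col₀ = x , x<a ,
      ≐′-trans (shifted-column-meet x ⊆col₀) ((λ _ → proj₂) , λ y o → colₓ⊆col₀ y o , o)

    -- Columns are nested, so each column of the shifted pattern is an old column.
    shifted-column : ∀ x → x < a → ∃ λ x* → x* < a × ShiftLeft O x ≐′ O x*
    shifted-column x x<a with suc x <? a
    ... | no x+1≮a = shifted-column-within x x<a (λ y o → contradiction (A .x-bound _ y o) x+1≮a)
    ... | yes x+1<a with columns-nested 0<b′ A (≤-<-trans z≤n x<a) x+1<a
    ...   | inj₁ col₀⊆ = suc x , x+1<a , shifted-column-suc x col₀⊆
    ...   | inj₂ ⊆col₀ = shifted-column-within x x<a ⊆col₀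

    shifted-x<a : ∀ x y → ShiftLeft O x y → x < a
    shifted-x<a x y (inj₁ (_ , o)) = A .x-bound x y o
    shifted-x<a x y (inj₂ (_ , o)) = <-trans (n<1+n x) (A .x-bound _ y o)

    shifted-row : ∀ y → y < b → Interval a a′ (λ x → ShiftLeft O x y)
    shifted-row y y<b with O? 0 y
    ... | yes o₀ = Interval-resp
      ((λ x o → inj₁ (o₀ , o)) , λ { x (inj₁ (_ , o)) → o ; x (inj₂ (¬o₀ , _)) → contradiction o₀ ¬o₀ })
      (A .row y y<b)
    ... | no ¬o₀ = Interval-resp
      ((λ x o → inj₂ (¬o₀ , o)) , λ { x (inj₁ (o₀ , _)) → contradiction o₀ ¬o₀ ; x (inj₂ (_ , o)) → o })
      (Interval-suc 0<a′ ¬o₀ (A .row y y<b))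

  Admissible-shiftLeft : Admissible a b a′ b′ (ShiftLeft O)
  Admissible-shiftLeft .row = shifted-row
  Admissible-shiftLeft .column x x<a with shifted-column x x<a
  ... | x* , x*<a , same = Interval-resp (≐′-sym same) (A .column x* x*<a)
  Admissible-shiftLeft .no-crossing x₁ y₁ x₂ y₂ ¬o₁ ¬o₂ o₁ o₂
    with shifted-column x₁ (shifted-x<a x₁ y₂ o₁) | shifted-column x₂ (shifted-x<a x₂ y₁ o₂)
  ... | x₁* , _ , (to₁ , from₁) | x₂* , _ , (to₂ , from₂) =
    A .no-crossing x₁* y₁ x₂* y₂ (λ o → ¬o₁ (from₁ y₁ o)) (λ o → ¬o₂ (from₂ y₂ o))
      (to₁ y₂ o₁) (to₂ y₁ o₂)
  Admissible-shiftLeft .x-bound = shifted-x<a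
  Admissible-shiftLeft .y-bound x y (inj₁ (_ , o)) = A .y-bound x y o
  Admissible-shiftLeft .y-bound x y (inj₂ (_ , o)) = A .y-bound (suc x) y o

youngDiagram⇒Admissible : ∀ {a b a′ b′} {O : Pattern} → (∀ x y → Dec (O x y)) →
  (∀ x y → O x y → x < a) → (∀ x y → O x y → y < b) →
  (∀ {x x′} y → O x y → x′ ≤ x → O x′ y) → (∀ x {y y′} → O x y → y′ ≤ y → O x y′) →
  (∀ x → x < a′ → ∀ y → y < b → O x y) → (∀ y → y < b′ → ∀ x → x < a → O x y) →
  Admissible a b a′ b′ O
youngDiagram⇒Admissible O? x<a y<b row-closed column-closed full-columns full-rows = λ where
  .row y y<b → downClosed⇒Interval (λ x → O? x y) (λ o → row-closed y o) (λ x o → x<a x y o)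
                 (λ x x<a′ → full-columns x x<a′ y y<b)
  .column x x<a → downClosed⇒Interval (O? x) (λ o → column-closed x o) (y<b x)
                    (λ y y<b′ → full-rows y y<b′ x x<a)
  .no-crossing x₁ y₁ x₂ y₂ ¬o₁₁ ¬o₂₂ o₁₂ o₂₁ → case ≤-total x₁ x₂ of λ where
    (inj₁ x₁≤x₂) → ¬o₁₁ (row-closed y₁ o₂₁ x₁≤x₂)
    (inj₂ x₂≤x₁) → ¬o₂₂ (row-closed y₂ o₁₂ x₂≤x₁)
  .x-bound → x<a
  .y-bound → y<b

-- Pushes fix central tokens

occupancy : ∀ {n} → Config n → Pattern
occupancy v x y = Occupied v (x , y)

-- the paper's core: a ∸ a′ ≤ x < a′ and b ∸ b′ ≤ y < b′
Central : ℕ → ℕ → ℕ → ℕ → Cell → Set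
Central a b a′ b′ (x , y) = a ≤ x + a′ × x < a′ × b ≤ y + b′ × y < b′

Central-reflectX : ∀ {a b a′ b′ x x̄ y} → Mirror a x x̄ → Central a b a′ b′ (x , y) → Central a b a′ b′ (x̄ , y)
Central-reflectX {a} {a′ = a′} {x = x} {x̄} m (a≤x+a′ , x<a′ , b≤y+b′ , y<b′) = a≤x̄+a′ , x̄<a′ , b≤y+b′ , y<b′
  where
  a≤x̄+a′ : a ≤ x̄ + a′
  a≤x̄+a′ = subst (_≤ x̄ + a′) (trans (+-suc x̄ x) (sum≡ (mirror-sym m))) (+-monoʳ-≤ x̄ x<a′)
  x̄<a′ : x̄ < a′
  x̄<a′ = +-cancelʳ-≤ x (suc x̄) a′
    (subst (_≤ a′ + x) (sym (sum≡ (mirror-sym m))) (subst (a ≤_) (+-comm x a′) a≤x+a′))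

Central-transpose : ∀ {a b a′ b′ p} → Central a b a′ b′ p → Central b a b′ a′ (swap p)
Central-transpose (a≤x+a′ , x<a′ , b≤y+b′ , y<b′) = b≤y+b′ , y<b′ , a≤x+a′ , x<a′

central⇒column₀ : ∀ {a b a′ b′} {O : Pattern} → Admissible a b a′ b′ O → 0 < a → ∀ {x y} →
  Central a b a′ b′ (x , y) → O 0 y
central⇒column₀ A 0<a {y = y} (_ , _ , b≤y+b′ , y<b′) = Interval-central (A .column 0 0<a) y b≤y+b′ y<b′

module _ {a b a′ b′ n : ℕ} where

  Admissible⇒normalized : (v : Config n) → Admissible a b a′ b′ (occupancy v) →
    0 < a′ → 0 < b′ → 0 < a → 0 < b → normalize v ≡ v
  Admissible⇒normalized v A 0<a′ 0<b′ 0<a 0<b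
    with Interval-lo 0<b′ (A .column 0 0<a) | Interval-lo 0<a′ (A .row 0 0<b)
  ... | (j₁ , vj₁≡) | (j₂ , vj₂≡) = normalize-fixed v (j₁ , cong proj₁ vj₁≡) (j₂ , cong proj₂ vj₂≡)

  hasGap-admissible : (d : Config n) → Admissible a b a′ b′ (occupancy d) → ∀ x y → Occupied d (x , y) →
    Sweep.hasGap d y x ≡ not (occupied d (0 , y))
  hasGap-admissible d A x y o with occupied? d (0 , y)
  ... | yes o₀ rewrite Occupied⇒occupied d _ o₀ = ¬-not noGap
    where
    noGap : Sweep.hasGap d y x ≢ true
    noGap gap with Sweep.hasGap⇒empty d y x gap
    ... | h , h<x , ¬o = ¬o (Admissible-row-convex A h y o₀ o z≤n (<⇒≤ h<x))
  ... | no ¬o₀ rewrite ¬Occupied⇒occupied≡false d _ ¬o₀ with x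
  ...   | zero = contradiction o ¬o₀
  ...   | suc x′ = Sweep.empty⇒hasGap d y (suc x′) 0 (s≤s z≤n) ¬o₀

leftShiftCell : ∀ {n} → Config n → Cell → Cell
leftShiftCell d (x , y) = if occupied d (0 , y) then (x , y) else (x ∸ 1 , y)

lookup-pushLeft-admissible : ∀ {a b a′ b′ n} (e : Config n) →
  Admissible a b a′ b′ (occupancy (normalize e)) → ∀ j →
  lookup (pushLeft e) j ≡ leftShiftCell (normalize e) (lookup (normalize e) j)
lookup-pushLeft-admissible e A j = trans (lookup-pushLeft e j) (shift (lookup d j) (j , refl))
  where
  d = normalize e
  shift : ∀ p → Occupied d p → Sweep.pushLeftCell d p ≡ leftShiftCell d p
  shift (x , y) o rewrite hasGap-admissible d A x y o with occupied d (0 , y)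
  ... | true = refl
  ... | false = refl

module _ {n} (d w : Config n) (w≡ : ∀ j → lookup w j ≡ leftShiftCell d (lookup d j)) where

  private
    from-cell : ∀ {x y} x₀ y₀ → Occupied d (x₀ , y₀) → leftShiftCell d (x₀ , y₀) ≡ (x , y) →
      ShiftLeft (occupancy d) x y
    from-cell x₀ y₀ o eq with occupied? d (0 , y₀)
    ... | yes o₀ rewrite Occupied⇒occupied d _ o₀ with refl ← eq = inj₁ (o₀ , o)
    ... | no ¬o₀ rewrite ¬Occupied⇒occupied≡false d _ ¬o₀ with x₀ | o | eq
    ...   | zero | o′ | _ = contradiction o′ ¬o₀
    ...   | suc _ | o′ | refl = inj₂ (¬o₀ , o′)

  occupancy-leftShift→ : ∀ x y → occupancy w x y → ShiftLeft (occupancy d) x y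
  occupancy-leftShift→ x y (j , wj≡) = from-cell _ _ (j , refl) (trans (sym (w≡ j)) wj≡)

  occupancy-leftShift← : ∀ x y → ShiftLeft (occupancy d) x y → occupancy w x y
  occupancy-leftShift← x y (inj₁ (o₀ , j , dj≡)) = j , trans (w≡ j) (trans (cong (leftShiftCell d) dj≡) stays)
    where
    stays : leftShiftCell d (x , y) ≡ (x , y)
    stays rewrite Occupied⇒occupied d _ o₀ = refl
  occupancy-leftShift← x y (inj₂ (¬o₀ , j , dj≡)) = j , trans (w≡ j) (trans (cong (leftShiftCell d) dj≡) moves)
    where
    moves : leftShiftCell d (suc x , y) ≡ (x , y)
    moves rewrite ¬Occupied⇒occupied≡false d _ ¬o₀ = refl

PushInvariant : ℕ → ℕ → ℕ → ℕ → ∀ {n} → Fin n → Cell → Config n → Set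
PushInvariant a b a′ b′ i p e = Admissible a b a′ b′ (occupancy (normalize e)) × lookup (normalize e) i ≡ p

module _ {a b a′ b′ n : ℕ} {i : Fin n} {p : Cell} where

  PushInvariant⇒inBox : ∀ {e} → PushInvariant a b a′ b′ i p e → proj₁ p < a × proj₂ p < b
  PushInvariant⇒inBox (A , ei≡p) = A .x-bound _ _ (i , ei≡p) , A .y-bound _ _ (i , ei≡p)

  pushLeft-preserves : ∀ e → 0 < a′ → 0 < b′ → Central a b a′ b′ p →
    PushInvariant a b a′ b′ i p e → PushInvariant a b a′ b′ i p (pushLeft e)
  pushLeft-preserves e 0<a′ 0<b′ central inv@(A , ei≡p) =
    subst (λ u → Admissible a b a′ b′ (occupancy u) × lookup u i ≡ p) (sym w-normalized) (A′ , stays)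
    where
    d = normalize e
    w = pushLeft e
    w≡ = lookup-pushLeft-admissible e A
    A′ : Admissible a b a′ b′ (occupancy w)
    A′ = Admissible-resp (occupancy-leftShift← d w w≡) (occupancy-leftShift→ d w w≡)
           (Admissible-shiftLeft (λ x y → occupied? d (x , y)) 0<a′ 0<b′ A)
    0<a = ≤-<-trans z≤n (proj₁ (PushInvariant⇒inBox {e = e} inv))
    0<b = ≤-<-trans z≤n (proj₂ (PushInvariant⇒inBox {e = e} inv))
    w-normalized : normalize w ≡ w
    w-normalized = Admissible⇒normalized w A′ 0<a′ 0<b′ 0<a 0<b
    stays : lookup w i ≡ p
    stays rewrite w≡ i | ei≡p | Occupied⇒occupied d _ (central⇒column₀ A 0<a central) = refl

reflectX-preserves : ∀ {a₀ b a′ b′ n} {i : Fin n} {p} e → 0 < a′ → 0 < b′ →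
  PushInvariant (suc a₀) b a′ b′ i p e →
  PushInvariant (suc a₀) b a′ b′ i (a₀ ∸ proj₁ p , proj₂ p) (reflectX e)
reflectX-preserves {a₀} {b} {a′} {b′} {i = i} {p} e 0<a′ 0<b′ inv@(A , ei≡p) =
  subst (λ u → Admissible (suc a₀) b a′ b′ (occupancy u) × lookup u i ≡ reflect p) (sym w-normalized)
    (A′ , trans (w≡ i) (cong reflect ei≡p))
  where
  d = normalize e
  w = reflectX e
  reflect : Cell → Cell
  reflect (x , y) = (a₀ ∸ x , y)
  x≤a₀ : ∀ {x y} → Occupied d (x , y) → x ≤ a₀
  x≤a₀ o = ≤-pred (A .x-bound _ _ o)
  maxX≡a₀ : maxV (xs d) ≡ a₀
  maxX≡a₀ = maxV-attained⇒≡ (xs d) a₀ (λ j → subst (_≤ a₀) (sym (lookup-xs d j)) (x≤a₀ (j , refl)))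
    (let (j , dj≡) = Interval-lo 0<b′ (A .column a₀ ≤-refl) in j , trans (lookup-xs d j) (cong proj₁ dj≡))
  w≡ : ∀ j → lookup w j ≡ reflect (lookup d j)
  w≡ j = trans (lookup-map j _ d) (cong (λ m → (m ∸ proj₁ (lookup d j) , proj₂ (lookup d j))) maxX≡a₀)
  to : ∀ x y → ReflectX (suc a₀) (occupancy d) x y → occupancy w x y
  to x y (x̄ , mirror m , j , dj≡) =
    j , trans (w≡ j) (trans (cong reflect dj≡)
          (cong (_, y) (trans (cong (_∸ x̄) (sym (suc-injective m))) (m+n∸n≡m x x̄))))
  from : ∀ x y → occupancy w x y → ReflectX (suc a₀) (occupancy d) x y
  from x y (j , wj≡) with lookup d j in dj≡ | trans (sym (w≡ j)) wj≡
  ... | (x̄ , .y) | refl = x̄ , mirror (cong suc (m∸n+n≡m (x≤a₀ (j , dj≡)))) , j , dj≡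
  A′ : Admissible (suc a₀) b a′ b′ (occupancy w)
  A′ = Admissible-resp to from (Admissible-reflectX A)
  w-normalized : normalize w ≡ w
  w-normalized = Admissible⇒normalized w A′ 0<a′ 0<b′ (s≤s z≤n)
    (≤-<-trans z≤n (proj₂ (PushInvariant⇒inBox {e = e} inv)))

pushRight-preserves : ∀ {a b a′ b′ n} {i : Fin n} {p} e → 0 < a′ → 0 < b′ → Central a b a′ b′ p →
  PushInvariant a b a′ b′ i p e → PushInvariant a b a′ b′ i p (pushRight e)
pushRight-preserves {zero} {i = i} e _ _ _ inv = contradiction (proj₁ (PushInvariant⇒inBox {i = i} {e = e} inv)) λ ()
pushRight-preserves {suc a₀} {b} {a′} {b′} {i = i} {p = x , y} e 0<a′ 0<b′ central inv =
  subst (λ x′ → PushInvariant (suc a₀) b a′ b′ i (x′ , y) (pushRight e)) (m∸[m∸n]≡n x≤a₀)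
    (reflectX-preserves (pushLeft (reflectX e)) 0<a′ 0<b′
      (pushLeft-preserves (reflectX e) 0<a′ 0<b′ (Central-reflectX m central)
        (reflectX-preserves e 0<a′ 0<b′ inv)))
  where
  x≤a₀ : x ≤ a₀
  x≤a₀ = ≤-pred (proj₁ (PushInvariant⇒inBox {i = i} {e = e} inv))
  m : Mirror (suc a₀) x (a₀ ∸ x)
  m = mirror (cong suc (m+[n∸m]≡n x≤a₀))

lookup-normalize-transpose : ∀ {n} (e : Config n) j → lookup (normalize (transpose e)) j ≡ swap (lookup (normalize e) j)
lookup-normalize-transpose e j
  rewrite lookup-normalize (transpose e) j | lookup-normalize e j | lookup-map j (λ q → proj₂ q , proj₁ q) e
  | sym (map-∘ proj₁ (λ q → proj₂ q , proj₁ q) e) | sym (map-∘ proj₂ (λ q → proj₂ q , proj₁ q) e) = refl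

Occupied-normalize-transpose : ∀ {n} (e : Config n) q →
  Occupied (normalize (transpose e)) q → Occupied (normalize e) (swap q)
Occupied-normalize-transpose e q (j , ej≡) = j , cong swap (trans (sym (lookup-normalize-transpose e j)) ej≡)

Occupied-normalize-transpose⁻ : ∀ {n} (e : Config n) q →
  Occupied (normalize e) (swap q) → Occupied (normalize (transpose e)) q
Occupied-normalize-transpose⁻ e q (j , ej≡) = j , trans (lookup-normalize-transpose e j) (cong swap ej≡)

PushInvariant-transpose : ∀ {a b a′ b′ n} {i : Fin n} {p} e →
  PushInvariant a b a′ b′ i p e → PushInvariant b a b′ a′ i (swap p) (transpose e)
PushInvariant-transpose {i = i} e (A , ei≡p) =
  Admissible-resp (λ x y → Occupied-normalize-transpose⁻ e (x , y)) (λ x y → Occupied-normalize-transpose e (x , y))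
    (Admissible-transpose A) ,
  trans (lookup-normalize-transpose e i) (cong swap ei≡p)

module _ {a b a′ b′ n : ℕ} {i : Fin n} {p : Cell}
  (0<a′ : 0 < a′) (0<b′ : 0 < b′) (central : Central a b a′ b′ p) where

  pushDown-preserves : ∀ e → PushInvariant a b a′ b′ i p e → PushInvariant a b a′ b′ i p (pushDown e)
  pushDown-preserves e inv = PushInvariant-transpose (pushLeft (transpose e))
    (pushLeft-preserves (transpose e) 0<b′ 0<a′ (Central-transpose central) (PushInvariant-transpose e inv))

  pushUp-preserves : ∀ e → PushInvariant a b a′ b′ i p e → PushInvariant a b a′ b′ i p (pushUp e)
  pushUp-preserves e inv = PushInvariant-transpose (pushRight (transpose e))
    (pushRight-preserves (transpose e) 0<b′ 0<a′ (Central-transpose central) (PushInvariant-transpose e inv))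

  pushes-preserve : ∀ ds e → PushInvariant a b a′ b′ i p e → PushInvariant a b a′ b′ i p (pushes ds e)
  pushes-preserve [] e inv = inv
  pushes-preserve (left ∷ ds) e inv = pushes-preserve ds _ (pushLeft-preserves e 0<a′ 0<b′ central inv)
  pushes-preserve (right ∷ ds) e inv = pushes-preserve ds _ (pushRight-preserves e 0<a′ 0<b′ central inv)
  pushes-preserve (up ∷ ds) e inv = pushes-preserve ds _ (pushUp-preserves e inv)
  pushes-preserve (down ∷ ds) e inv = pushes-preserve ds _ (pushDown-preserves e inv)

-- Canonical configurations are admissible

module _ {n} (c : Config n) where

  private
    d = normalize c

  proj₂-pushLeft : ∀ j → proj₂ (lookup (pushLeft c) j) ≡ proj₂ (lookup d j)
  proj₂-pushLeft j rewrite lookup-pushLeft c j with Sweep.hasGap d (proj₂ (lookup d j)) (proj₁ (lookup d j))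
  ... | true = refl
  ... | false = refl

  proj₁-pushLeft-0 : ∀ j → proj₁ (lookup d j) ≡ 0 → proj₁ (lookup (pushLeft c) j) ≡ 0
  proj₁-pushLeft-0 j x≡0 = trans (cong proj₁ (lookup-pushLeft c j)) (stays (lookup d j) x≡0)
    where
    stays : ∀ q → proj₁ q ≡ 0 → proj₁ (Sweep.pushLeftCell d q) ≡ 0
    stays (_ , y) refl = refl

  pushLeft-vacates : ∀ m y → Sweep.hasGap d y m ≡ true → ¬ Occupied d (suc m , y) → ¬ Occupied (pushLeft c) (m , y)
  pushLeft-vacates m y gap ¬o′ (j , pj≡) = lands (lookup d j) (j , refl) (trans (sym (lookup-pushLeft c j)) pj≡)
    where
    lands : ∀ q → Occupied d q → Sweep.pushLeftCell d q ≡ (m , y) → ⊥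
    lands (x , y′) o eq with Sweep.hasGap d y′ x in gap′
    lands (zero , y′) o eq | true with () ← gap′
    lands (suc x , y′) o refl | true = ¬o′ o
    lands (x , y′) o refl | false with () ← trans (sym gap) gap′

pushLeft-normalized : ∀ {n} (c : Config (suc n)) → normalize (pushLeft c) ≡ pushLeft c
pushLeft-normalized c with normalize-touches-x0 c | normalize-touches-y0 c
... | j₁ , x≡0 | j₂ , y≡0 =
  normalize-fixed (pushLeft c) (j₁ , proj₁-pushLeft-0 c j₁ x≡0) (j₂ , trans (proj₂-pushLeft c j₂) y≡0)

occupied⇒<width : ∀ {n} (c : Config n) x y → Occupied (normalize c) (x , y) → x < width c
occupied⇒<width c x y (j , cj≡) =
  s≤s (subst (_≤ maxV (xs (normalize c))) (trans (lookup-xs (normalize c) j) (cong proj₁ cj≡))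
         (lookup≤maxV (xs (normalize c)) j))

occupied⇒<height : ∀ {n} (c : Config n) x y → Occupied (normalize c) (x , y) → y < height c
occupied⇒<height c x y (j , cj≡) =
  s≤s (subst (_≤ maxV (ys (normalize c))) (trans (lookup-ys (normalize c) j) (cong proj₂ cj≡))
         (lookup≤maxV (ys (normalize c)) j))

LeftStable : ∀ {n} → Config n → Set
LeftStable c = ∀ q → Occupied (normalize c) q → Occupied (normalize (pushLeft c)) q

-- If (x′ , y) were empty, the run of occupied cells through (x , y) would end at some (m , y),
-- and pushLeft would empty that cell.
rows-closed : ∀ {n} (c : Config (suc n)) → LeftStable c →
  ∀ {x x′} y → Occupied (normalize c) (x , y) → x′ ≤ x → Occupied (normalize c) (x′ , y)
rows-closed c stable {x} {x′} y o x′≤x with occupied? (normalize c) (x′ , y)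
... | yes o′ = o′
... | no ¬o′ with lastOfRun (λ z → occupied? (normalize c) (z , y)) (width c) (λ z o → occupied⇒<width c z y o) x o
...   | m , x≤m , om , ¬om′ =
  ⊥-elim (pushLeft-vacates c m y gap ¬om′ (subst (λ u → Occupied u (m , y)) (pushLeft-normalized c) (stable (m , y) om)))
  where
  gap : Sweep.hasGap (normalize c) y m ≡ true
  gap = Sweep.empty⇒hasGap (normalize c) y m x′ (<-≤-trans (≤∧≢⇒< x′≤x λ { refl → ¬o′ o }) x≤m) ¬o′

all-upTo⇒ : ∀ (p : ℕ → Bool) m → ListAction.all p (upTo m) ≡ true → ∀ y → y < m → p y ≡ true
all-upTo⇒ p m all≡ y y<m =
  Equivalence.to T-≡ (All.lookup (AllP.all⁺ p (upTo m) (Equivalence.from T-≡ all≡)) (∈-upTo⁺ y<m))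

⇒all-upTo : ∀ (p : ℕ → Bool) m → (∀ y → y < m → p y ≡ true) → ListAction.all p (upTo m) ≡ true
⇒all-upTo p m p≡ =
  Equivalence.to T-≡ (AllP.all⁻ p (All.tabulate λ y∈ → Equivalence.from T-≡ (p≡ _ (∈-upTo⁻ y∈))))

firstLines-full : ∀ (full : ℕ → Bool) W → (∀ {z x} → full z ≡ true → x ≤ z → full x ≡ true) →
  ∀ x → x < length (filter (λ z → full z Data.Bool.≟ true) (upTo W)) → full x ≡ true
firstLines-full full W closed x x<count with full x in fx
... | true = refl
... | false = contradiction (count≤ (λ z → full z Data.Bool.≟ true) W x below) (<⇒≱ x<count)
  where
  below : ∀ z → z < W → full z ≡ true → z < x
  below z _ fz with z <? x
  ... | yes z<x = z<x
  ... | no z≮x with () ← trans (sym fx) (closed fz (≮⇒≥ z≮x))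

module _ {n} (c : Config (suc n)) (canonical : Canonical c) where

  private
    d = normalize c

    leftStable : LeftStable c
    leftStable q o = ∈⇒Occupied _ q (Equivalence.from (proj₁ canonical q) (Occupied⇒∈ d q o))

    transpose-leftStable : LeftStable (transpose c)
    transpose-leftStable q o = Occupied-normalize-transpose (pushLeft (transpose c)) (swap q)
      (∈⇒Occupied _ (swap q) (Equivalence.from (proj₂ canonical (swap q))
        (Occupied⇒∈ d (swap q) (Occupied-normalize-transpose c q o))))

    columns-closed : ∀ x {y y′} → Occupied d (x , y) → y′ ≤ y → Occupied d (x , y′)
    columns-closed x {y} {y′} o y′≤y = Occupied-normalize-transpose c (y′ , x)
      (rows-closed (transpose c) transpose-leftStable x (Occupied-normalize-transpose⁻ c (y , x) o) y′≤y)

    fullCol⇒ : ∀ x → fullCol c x ≡ true → ∀ y → y < height c → Occupied d (x , y)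
    fullCol⇒ x full y y<h = occupied⇒Occupied d _ (all-upTo⇒ _ (height c) full y y<h)

    fullRow⇒ : ∀ y → fullRow c y ≡ true → ∀ x → x < width c → Occupied d (x , y)
    fullRow⇒ y full x x<w = occupied⇒Occupied d _ (all-upTo⇒ _ (width c) full x x<w)

    full-columns : ∀ x → x < fullCols c → ∀ y → y < height c → Occupied d (x , y)
    full-columns x x<a′ = fullCol⇒ x (firstLines-full (fullCol c) (width c) closed x x<a′)
      where
      closed : ∀ {z x} → fullCol c z ≡ true → x ≤ z → fullCol c x ≡ true
      closed {z} full x≤z = ⇒all-upTo _ (height c) λ y y<h →
        Occupied⇒occupied d _ (rows-closed c leftStable y (fullCol⇒ z full y y<h) x≤z)

    full-rows : ∀ y → y < fullRows c → ∀ x → x < width c → Occupied d (x , y)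
    full-rows y y<b′ = fullRow⇒ y (firstLines-full (fullRow c) (height c) closed y y<b′)
      where
      closed : ∀ {z y} → fullRow c z ≡ true → y ≤ z → fullRow c y ≡ true
      closed {z} full y≤z = ⇒all-upTo _ (width c) λ x x<w →
        Occupied⇒occupied d _ (columns-closed x (fullRow⇒ z full x x<w) y≤z)

  canonical⇒Admissible : Admissible (width c) (height c) (fullCols c) (fullRows c) (occupancy d)
  canonical⇒Admissible = youngDiagram⇒Admissible (λ x y → occupied? d (x , y))
    (occupied⇒<width c) (occupied⇒<height c) (rows-closed c leftStable) columns-closed full-columns full-rows

fullCols≤width : ∀ {n} (c : Config n) → fullCols c ≤ width c
fullCols≤width c = subst (fullCols c ≤_) (length-upTo (width c))
  (length-filter (λ x → fullCol c x Data.Bool.≟ true) (upTo (width c)))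

fullRows≤height : ∀ {n} (c : Config n) → fullRows c ≤ height c
fullRows≤height c = subst (fullRows c ≤_) (length-upTo (height c))
  (length-filter (λ y → fullRow c y Data.Bool.≟ true) (upTo (height c)))

InCore⇒Central : ∀ {n} (c : Config n) p → InCore c p → Central (width c) (height c) (fullCols c) (fullRows c) p
InCore⇒Central c (x , y) (_ , _ , a″≤x , x<a−a″ , b″≤y , y<b−b″) =
  ∸≤⇒≤+ (width c) (fullCols c) a″≤x , subst (x <_) (m∸[m∸n]≡n (fullCols≤width c)) x<a−a″ ,
  ∸≤⇒≤+ (height c) (fullRows c) b″≤y , subst (y <_) (m∸[m∸n]≡n (fullRows≤height c)) y<b−b″
  where
  ∸≤⇒≤+ : ∀ m k {x} → m ∸ k ≤ x → m ≤ x + k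
  ∸≤⇒≤+ m k {x} m∸k≤x = subst (m ≤_) (+-comm k x) (≤-trans (m≤n+m∸n m k) (+-monoʳ-≤ k m∸k≤x))

mainTheorem13 : ∀ {n} (c : Config n) → Labelled c → Canonical c →
    (π : Permutation′ n) → InG c π →
    (i : Fin n) → InCore c (lookup (normalize c) i) → π ⟨$⟩ʳ i ≡ i
mainTheorem13 {suc n} c labelled canonical π (ds , pushed) i core =
  labelled (π ⟨$⟩ʳ i) i (normalize-injective c (π ⟨$⟩ʳ i) i (trans (sym (pushed i)) stays))
  where
  0<a′ = ≤-<-trans z≤n (proj₁ core)
  0<b′ = ≤-<-trans z≤n (proj₁ (proj₂ core))
  stays : lookup (normalize (pushes ds c)) i ≡ lookup (normalize c) i
  stays = proj₂ (pushes-preserve 0<a′ 0<b′ (InCore⇒Central c _ core) ds c (canonical⇒Admissible c canonical , refl))
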